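{- Let $\mathcal{M}$ be an $n$-maniplex, let $i\in[n]$, let $F$ be an $i$-face of $\mathcal{M}$ and let $u,v$ be flags in $F$. Then there exists a flag $w\in F$ such that there is a path in $\mathcal{M}$ from $u$ to $w$ all of whose edges have colours smaller than $i$, and a path from $w$ to $v$ all of whose edges have colours greater than $i$.
   Context: Write $[n]=\{0,1,\dots,n-1\}$. An $n$-maniplex is a simple graph $\mathcal{M}$ whose edges are coloured with colours from $[n]$ so that every vertex (called a flag) is incident to exactly one edge of each colour, and such that for all $i,j\in[n]$ with $|i-j|>1$, every connected component of the subgraph formed by all vertices and the edges of colours $i$ and $j$ is a $4$-cycle. For $i\in[n]$, an $i$-face of $\mathcal{M}$ is a connected component of the spanning subgraph of $\mathcal{M}$ consisting of all edges whose colour is not $i$. Paths may have length zero. -}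

module Defs where

open import Level using (Level; _⊔_; suc)
open import Data.Nat using (ℕ; _<_; _>_)
open import Data.Fin using (Fin; toℕ)
open import Data.Sum using (_⊎_)
open import Data.Product using (Σ; _×_; ∃; ∃-syntax)
open import Relation.Binary.PropositionalEquality using (_≡_; _≢_)
open import Relation.Nullary using (¬_)

NonAdjacent : {n : ℕ} → Fin n → Fin n → Set
NonAdjacent i j = (toℕ i) > ℕ.suc (toℕ j) ⊎ (toℕ j) > ℕ.suc (toℕ i)

-- An n-maniplex: a simple graph on a type of flags, with an edge-colouring
-- by colours in Fin n.  Edge i x y means: {x,y} is an edge, of colour i.
record Maniplex (n : ℕ) (a b : Level) : Set (Level.suc (a ⊔ b)) where
  field
    Flag : Set a
    Edge : Fin n → Flag → Flag → Set b
    edge-sym    : ∀ {i x y} → Edge i x y → Edge i y x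
    edge-irrefl : ∀ {i x} → ¬ Edge i x x
    edge-colour : ∀ {i j x y} → Edge i x y → Edge j x y → i ≡ j
    edge-exists : ∀ (i : Fin n) (x : Flag) → ∃[ y ] Edge i x y
    edge-unique : ∀ {i x y z} → Edge i x y → Edge i x z → y ≡ z
    -- for |i-j|>1, every component of the {i,j}-subgraph is a 4-cycle:
    -- (each flag has exactly one i-edge and one j-edge there, so its component
    --  is the alternating cycle through it; we require this to be a 4-cycle)
    four-cycle : ∀ (i j : Fin n) → NonAdjacent i j → ∀ (x : Flag) →
      Σ Flag λ a → Σ Flag λ b → Σ Flag λ c →
        Edge i x a × Edge j a b × Edge i b c × Edge j c x ×
        x ≢ a × x ≢ b × x ≢ c × a ≢ b × a ≢ c × b ≢ c

module _ {n : ℕ} {a b : Level} (M : Maniplex n a b) where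
  open Maniplex M

  data PathIn (P : Fin n → Set) : Flag → Flag → Set (a ⊔ b) where
    []  : ∀ {x} → PathIn P x x
    _∷_ : ∀ {x y z} {k : Fin n} → (Edge k x y × P k) → PathIn P y z → PathIn P x z

  -- x and y lie in the same i-face: they are joined by a path avoiding colour i
  SameFace : Fin n → Flag → Flag → Set (a ⊔ b)
  SameFace i x y = PathIn (λ k → k ≢ i) x y

-- Join u to v through the face (back from u to the base flag, then on to v) and
-- sort the colours of this path: an edge of colour above i followed by an edge
-- of colour below i are non-adjacent colours, so the 4-cycle they span lets us
-- swap them.  Bubbling every high edge past the low edges after it leaves a
-- path of low colours followed by a path of high colours.

module Submission where

open import Defs
open import Level using (Level)
open import Data.Nat using (ℕ; _<_; _>_)
open import Data.Nat.Properties using (≤-<-trans; <-irrefl; <-cmp)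
open import Data.Fin using (Fin; toℕ)
open import Data.Fin.Properties using (toℕ-injective)
open import Data.Product using (Σ; _×_; _,_)
open import Data.Sum using (inj₂)
open import Relation.Binary using (tri<; tri≈; tri>)
open import Relation.Binary.PropositionalEquality using (refl; _≢_)
open import Data.Empty using (⊥-elim)

module _ {n : ℕ} where

  Below Above : Fin n → Fin n → Set
  Below i k = toℕ k < toℕ i
  Above i k = toℕ k > toℕ i

  below-above⇒nonAdjacent : ∀ {i j k} → Below i j → Above i k → NonAdjacent j k
  below-above⇒nonAdjacent j<i i<k = inj₂ (≤-<-trans j<i i<k)

  below⇒≢ : ∀ {i k} → Below i k → k ≢ i
  below⇒≢ k<i refl = <-irrefl refl k<i

module PathProperties {a b : Level} {n : ℕ} (M : Maniplex n a b) where
  open Maniplex M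

  _++_ : ∀ {P x y z} → PathIn M P x y → PathIn M P y z → PathIn M P x z
  [] ++ q = q
  (e ∷ p) ++ q = e ∷ (p ++ q)

  _∷ʳ_ : ∀ {P x y z k} → PathIn M P x y → Edge k y z × P k → PathIn M P x z
  [] ∷ʳ e = e ∷ []
  (e′ ∷ p) ∷ʳ e = e′ ∷ (p ∷ʳ e)

  reverse : ∀ {P x y} → PathIn M P x y → PathIn M P y x
  reverse [] = []
  reverse ((e , pk) ∷ p) = reverse p ∷ʳ (edge-sym e , pk)

  map : ∀ {P Q : Fin n → Set} {x y} → (∀ {k} → P k → Q k) →
        PathIn M P x y → PathIn M Q x y
  map f [] = []
  map f ((e , pk) ∷ p) = (e , f pk) ∷ map f p

  -- In the 4-cycle x –j– a –k– b –j– c –k– x, uniqueness of the k- and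
  -- j-edges at the given y forces c = y and b = z.
  commute : ∀ {j k x y z} → NonAdjacent j k → Edge k x y → Edge j y z →
            Σ Flag λ a → Edge j x a × Edge k a z
  commute {j} {k} {x} j≁k exy eyz with four-cycle j k j≁k x
  ... | a , _ , _ , exa , eab , ebc , ecx , _
    with refl ← edge-unique (edge-sym ecx) exy
    with refl ← edge-unique (edge-sym ebc) eyz = a , exa , eab

  commute-path : ∀ {P : Fin n → Set} {k x y w} → (∀ {j} → P j → NonAdjacent j k) →
                 Edge k x y → PathIn M P y w →
                 Σ Flag λ w′ → PathIn M P x w′ × Edge k w′ w
  commute-path {x = x} _ e [] = x , [] , e
  commute-path ≁k e ((e′ , pj) ∷ p) with commute (≁k pj) e e′
  ... | a , exa , eak with commute-path ≁k eak p
  ... | w′ , q , e″ = w′ , (exa , pj) ∷ q , e″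

  sort : ∀ {i u v} → SameFace M i u v →
         Σ Flag λ w → PathIn M (Below i) u w × PathIn M (Above i) w v
  sort {u = u} [] = u , [] , []
  sort {i} (_∷_ {k = k} (e , k≢i) p) with sort p
  ... | w , lo , hi with <-cmp (toℕ k) (toℕ i)
  ... | tri< k<i _ _ = w , (e , k<i) ∷ lo , hi
  ... | tri≈ _ k≡i _ = ⊥-elim (k≢i (toℕ-injective k≡i))
  ... | tri> _ _ k>i with commute-path (λ j<i → below-above⇒nonAdjacent j<i k>i) e lo
  ...   | w′ , lo′ , e′ = w′ , lo′ , (e′ , k>i) ∷ hi

lemma5p1 : {a b : Level} {n : ℕ} (M : Maniplex n a b) (i : Fin n)
    (F₀ u v : Maniplex.Flag M) →
    SameFace M i F₀ u → SameFace M i F₀ v →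
    Σ (Maniplex.Flag M) λ w →
      SameFace M i F₀ w ×
      PathIn M (λ k → toℕ k < toℕ i) u w ×
      PathIn M (λ k → toℕ k > toℕ i) w v
lemma5p1 M i F₀ u v F₀⇝u F₀⇝v =
  let w , u⇝w , w⇝v = sort (reverse F₀⇝u ++ F₀⇝v)
  in  w , F₀⇝u ++ map below⇒≢ u⇝w , u⇝w , w⇝v
  where open PathProperties M
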